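{- Let $H$ be a directed $k$-uniform hypergraph. For any acyclic set $A$ of $H$, we have $\Theta(H)\geq |A|$.
   Context: A directed $k$-uniform hypergraph is a pair $H=(V,E)$ with $V$ finite and $E$ a set of $k$-tuples of elements of $V$. To $H$ associate the directed graph $G_H$ with vertex set $V$ and edge set $\{(a_1,a_2):(a_1,a_2,\dots,a_k)\in E\text{ for some }a_3,\dots,a_k\}$. For $A\subseteq V$, $H[A]$ is the directed $k$-uniform hypergraph with vertices $A$ and edges $E\cap A^{\times k}$. $A$ is an acyclic set of $H$ if $G_{H[A]}$ is a directed acyclic graph. The strong product $G\boxtimes H$ has vertex set $V_G\times V_H$, and $((g_1,h_1),\dots,(g_k,h_k))$ is an edge iff either ($g_1=\dots=g_k$ and $(h_i)_i\in E_H$), or ($(g_i)_i\in E_G$ and $h_1=\dots=h_k$), or ($(g_i)_i\in E_G$ and $(h_i)_i\in E_H$). $H^{\boxtimes n}$ is the $n$-fold strong product. An independent set contains no edge entirely; $\alpha(H)$ is the maximum size of an independent set; $\Theta(H)=\lim_{n\to\infty}\alpha(H^{\boxtimes n})^{1/n}$. -}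

module Defs where

open import Level using (0ℓ)
open import Data.Nat using (ℕ; zero; suc; _≤_; _<_; _*_; _^_)
open import Data.Fin using (Fin; zero; suc)
open import Data.Unit using (⊤; tt)
open import Data.Empty using (⊥)
open import Data.Product using (Σ; ∃; _×_; _,_; proj₁; proj₂)
open import Data.Sum using (_⊎_)
open import Data.List using (List; length)
open import Data.List.Membership.Propositional using (_∈_)
open import Data.List.Relation.Unary.Unique.Propositional using (Unique)
open import Relation.Nullary using (¬_)
open import Relation.Binary.PropositionalEquality using (_≡_)
open import Relation.Binary.Construct.Closure.Transitive using (TransClosure)
open import Function.Bundles using (_↔_)

record DHG (k : ℕ) : Set₁ where
  field
    V : Set
    E : (Fin k → V) → Set
open DHG public

IsFinite : ∀ {k} → DHG k → Set
IsFinite H = Σ ℕ λ s → Fin s ↔ V H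

Const : ∀ {k} {X : Set} → (Fin k → X) → Set
Const {k} t = (i j : Fin k) → t i ≡ t j

_⊠_ : ∀ {k} → DHG k → DHG k → DHG k
G ⊠ H = record
  { V = V G × V H
  ; E = λ t →
      (Const (λ i → proj₁ (t i)) × E H (λ i → proj₂ (t i)))
    ⊎ (E G (λ i → proj₁ (t i)) × Const (λ i → proj₂ (t i)))
    ⊎ (E G (λ i → proj₁ (t i)) × E H (λ i → proj₂ (t i)))
  }

Unit : ∀ {k} → DHG k
Unit = record { V = ⊤ ; E = λ _ → ⊥ }

_^⊠_ : ∀ {k} → DHG k → ℕ → DHG k
H ^⊠ zero = Unit
H ^⊠ suc n = (H ^⊠ n) ⊠ H

-- finite subsets of V represented as duplicate-free lists; |A| = length A
AllIn : ∀ {k} {X : Set} → (Fin k → X) → List X → Set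
AllIn {k} t A = (i : Fin k) → t i ∈ A

-- the directed graph G_{H[A]} (k = m + 2): (a,b) is an edge iff some edge
-- (a₁,a₂,…,a_k) of H lies entirely in A with a₁ = a, a₂ = b
GraphOfInduced : ∀ {m} (H : DHG (suc (suc m))) → List (V H) → V H → V H → Set
GraphOfInduced H A a b =
  ∃ λ t → E H t × AllIn t A × t zero ≡ a × t (suc zero) ≡ b

IsAcyclicSet : ∀ {m} (H : DHG (suc (suc m))) → List (V H) → Set
IsAcyclicSet H A = Unique A × (∀ a → ¬ TransClosure (GraphOfInduced H A) a a)

IsIndependent : ∀ {k} (H : DHG k) → List (V H) → Set
IsIndependent H S = Unique S × (∀ t → E H t → ¬ AllIn t S)

αAtLeast : ∀ {k} (H : DHG k) → ℕ → Set
αAtLeast H r = ∃ λ S → IsIndependent H S × r ≤ length S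

{-# OPTIONS --safe #-}

-- Let a = |A|.  A vertex of H^⊠n is an n-tuple of vertices of H; sort the tuples over A by
-- their type, the number of occurrences of each vertex of A.  There are at most (n+1)^a types,
-- so some type class has at least a^n / (n+1)^a elements.  Every type class is independent in
-- H^⊠n: acyclicity of A yields a rank f on A that increases strictly along the edges of
-- G_{H[A]}, so along an edge of H^⊠n inside A^n the sum of f over the coordinates increases
-- strictly from the first vertex to the second, whereas it is the same for all tuples of one
-- type.  As (n+1)^a grows subexponentially, a^n / (n+1)^a ≥ (p/q)^n for large n when p/q < a.
--
-- The rank (the number of predecessors in A for the transitive closure of G_{H[A]}) needs that
-- closure to be decidable, which is only available under double negation; this suffices since
-- independence is a negative statement.

module Submission where

open import Defs

open import Data.Empty using (⊥-elim)
open import Data.Fin as Fin using (Fin; zero; suc)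
open import Data.Fin.Properties using (sequence)
open import Data.List
  using (List; []; _∷_; [_]; _++_; length; map; filter; cartesianProductWith; cartesianProduct; upTo)
open import Data.List.Extrema.Nat using (argmax; f[xs]≤f[argmax])
open import Data.List.Membership.Propositional using (_∈_)
open import Data.List.Membership.Propositional.Properties
  using (∈-cartesianProductWith⁺; ∈-cartesianProduct⁻; ∈-filter⁻; ∈-upTo⁺)
open import Data.List.Properties
  using ( length-upTo; length-++; length-map; length-filter; filter-++; filter-accept
        ; filter-reject; map-cong; map-cong-local; ∷-injective; ≡-dec)
open import Data.List.Relation.Unary.All as All using (All; []; _∷_)
open import Data.List.Relation.Unary.AllPairs using ([]; _∷_)
open import Data.List.Relation.Unary.Any using (here; there)
open import Data.List.Relation.Unary.Unique.Propositional using (Unique)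
import Data.List.Relation.Unary.Unique.Propositional.Properties as Unique
open import Data.Nat using (ℕ; zero; suc; _+_; _*_; _^_; _≤_; _<_; s≤s; z≤n; _≟_)
open import Data.Nat.ListAction using (sum)
open import Data.Nat.Properties
open import Algebra.Properties.CommutativeSemigroup *-commutativeSemigroup
  using (x∙yz≈y∙xz; x∙yz≈y∙zx; x∙yz≈xz∙y)
open import Algebra.Properties.CommutativeSemigroup +-commutativeSemigroup
  using () renaming (interchange to +-interchange)
open import Data.Nat.Tactic.RingSolver using (solve-∀)
open import Data.Product using (∃; _×_; _,_; proj₁; proj₂)
open import Data.Sum using (inj₁; inj₂)
open import Data.Unit using (tt)
open import Effect.Applicative using (RawApplicative)
open import Effect.Monad using (RawMonad)
open import Function using (_∘_; id)
open import Function.Bundles using (_↔_; Inverse)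
open import Function.Properties.Inverse using (↔-sym; ↔⇒↣)
open import Relation.Binary.Construct.Closure.Transitive
  using (TransClosure; _∷ʳ_) renaming ([_] to [_]⁺)
open import Relation.Binary.Core using (_Preserves_⟶_)
open import Relation.Binary.Definitions using (Decidable; DecidableEquality)
open import Relation.Binary.PropositionalEquality
  using (_≡_; _≢_; refl; sym; trans; cong; cong₂; subst; subst₂; ≢-sym; module ≡-Reasoning)
open import Relation.Nullary using (¬_; Dec; yes; no)
open import Relation.Nullary.Decidable using (via-injection; ¬¬-excluded-middle)
open import Relation.Nullary.Negation using (¬¬-Monad; ¬¬-map)
open import Relation.Nullary.Negation.Core using (DoubleNegation)
open import Relation.Unary using () renaming (Decidable to Decidable₁)

^-distrib-* : ∀ m n o → (m * n) ^ o ≡ m ^ o * n ^ o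
^-distrib-* m n zero    = refl
^-distrib-* m n (suc o) =
  trans (cong (m * n *_) (^-distrib-* m n o)) ([m*n]*[o*p]≡[m*o]*[n*p] m n (m ^ o) (n ^ o))

m^n*[1+n]≤[1+m]^[1+n] : ∀ m n → m ^ n * suc n ≤ suc m ^ suc n
m^n*[1+n]≤[1+m]^[1+n] m zero    = s≤s z≤n
m^n*[1+n]≤[1+m]^[1+n] m (suc n) = begin
  m ^ suc n * suc (suc n)           ≡⟨ *-suc (m ^ suc n) (suc n) ⟩
  m ^ suc n + m ^ suc n * suc n     ≡⟨ cong (m ^ suc n +_) (*-assoc m (m ^ n) (suc n)) ⟩
  m ^ suc n + m * (m ^ n * suc n)   ≤⟨ +-mono-≤ (^-monoˡ-≤ (suc n) (n≤1+n m))
                                               (*-monoʳ-≤ m (m^n*[1+n]≤[1+m]^[1+n] m n)) ⟩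
  suc m ^ suc n + m * suc m ^ suc n ∎
  where open ≤-Reasoning

-- Induction on d, passing from a < b to 2a < a + b < 2b and scaling by 2 ^ n.
a^n*[1+n]^d≤C*b^n : ∀ d {a b} → a < b → ∃ λ C → ∀ n → a ^ n * suc n ^ d ≤ C * b ^ n
a^n*[1+n]^d≤C*b^n zero {a} {b} a<b = 1 , λ n → begin
  a ^ n * 1  ≡⟨ *-identityʳ (a ^ n) ⟩
  a ^ n      ≤⟨ ^-monoˡ-≤ n (<⇒≤ a<b) ⟩
  b ^ n      ≡⟨ *-identityˡ (b ^ n) ⟨
  1 * b ^ n  ∎
  where open ≤-Reasoning
a^n*[1+n]^d≤C*b^n (suc d) {a} {b} a<b =
  C * suc (a + b) , λ n → *-cancelˡ-≤ (2 ^ n) {{m^n≢0 2 n}} (scaled n)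
  where
  open ≤-Reasoning
  2a<a+b : 2 * a < a + b
  2a<a+b = subst (_< a + b) (cong (a +_) (sym (+-identityʳ a))) (+-monoʳ-< a a<b)
  a+b<2b : a + b < 2 * b
  a+b<2b = subst (a + b <_) (cong (b +_) (sym (+-identityʳ b))) (+-monoˡ-< b a<b)
  C : ℕ
  C = proj₁ (a^n*[1+n]^d≤C*b^n d 2a<a+b)
  bound : ∀ n → (2 * a) ^ n * suc n ^ d ≤ C * (a + b) ^ n
  bound = proj₂ (a^n*[1+n]^d≤C*b^n d 2a<a+b)
  shuffleˡ : ∀ t x s e → t * (x * (s * e)) ≡ s * (t * x * e)
  shuffleˡ = solve-∀
  shuffleʳ : ∀ c s t x → c * (s * (t * x)) ≡ t * (c * s * x)
  shuffleʳ = solve-∀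
  scaled : ∀ n → 2 ^ n * (a ^ n * suc n ^ suc d) ≤ 2 ^ n * (C * suc (a + b) * b ^ n)
  scaled n = begin
    2 ^ n * (a ^ n * (suc n * suc n ^ d))
      ≡⟨ shuffleˡ (2 ^ n) (a ^ n) (suc n) _ ⟩
    suc n * (2 ^ n * a ^ n * suc n ^ d)
      ≡⟨ cong (λ x → suc n * (x * suc n ^ d)) (^-distrib-* 2 a n) ⟨
    suc n * ((2 * a) ^ n * suc n ^ d)
      ≤⟨ *-monoʳ-≤ (suc n) (bound n) ⟩
    suc n * (C * (a + b) ^ n)
      ≡⟨ x∙yz≈y∙zx (suc n) C _ ⟩
    C * ((a + b) ^ n * suc n)
      ≤⟨ *-monoʳ-≤ C (m^n*[1+n]≤[1+m]^[1+n] (a + b) n) ⟩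
    C * (suc (a + b) * suc (a + b) ^ n)
      ≤⟨ *-monoʳ-≤ C (*-monoʳ-≤ (suc (a + b)) (^-monoˡ-≤ n a+b<2b)) ⟩
    C * (suc (a + b) * (2 * b) ^ n)
      ≡⟨ cong (λ x → C * (suc (a + b) * x)) (^-distrib-* 2 b n) ⟩
    C * (suc (a + b) * (2 ^ n * b ^ n))
      ≡⟨ shuffleʳ C (suc (a + b)) (2 ^ n) (b ^ n) ⟩
    2 ^ n * (C * suc (a + b) * b ^ n)
      ∎

a^n*[1+n]^d≤b^n-eventually : ∀ d {a b} → a < b →
                             ∃ λ N → ∀ n → N ≤ n → a ^ n * suc n ^ d ≤ b ^ n
a^n*[1+n]^d≤b^n-eventually d {a} {b} a<b = C , λ n C≤n → *-cancelˡ-≤ (suc n) (begin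
  suc n * (a ^ n * suc n ^ d)  ≡⟨ x∙yz≈y∙xz (suc n) (a ^ n) _ ⟩
  a ^ n * suc n ^ suc d        ≤⟨ bound n ⟩
  C * b ^ n                    ≤⟨ *-monoˡ-≤ (b ^ n) (m≤n⇒m≤1+n C≤n) ⟩
  suc n * b ^ n                ∎)
  where
  open ≤-Reasoning
  C : ℕ
  C = proj₁ (a^n*[1+n]^d≤C*b^n (suc d) a<b)
  bound : ∀ n → a ^ n * suc n ^ suc d ≤ C * b ^ n
  bound = proj₂ (a^n*[1+n]^d≤C*b^n (suc d) a<b)

sum-map-+ : ∀ {A : Set} (f g : A → ℕ) xs →
            sum (map (λ x → f x + g x) xs) ≡ sum (map f xs) + sum (map g xs)
sum-map-+ f g []       = refl
sum-map-+ f g (x ∷ xs) = begin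
  f x + g x + sum (map (λ x → f x + g x) xs)     ≡⟨ cong (f x + g x +_) (sum-map-+ f g xs) ⟩
  f x + g x + (sum (map f xs) + sum (map g xs))  ≡⟨ +-interchange (f x) (g x) _ _ ⟩
  f x + sum (map f xs) + (g x + sum (map g xs))  ∎
  where open ≡-Reasoning

sum-map-≤ : ∀ {A : Set} (f : A → ℕ) {c} xs → All (λ x → f x ≤ c) xs →
            sum (map f xs) ≤ length xs * c
sum-map-≤ f []       []          = z≤n
sum-map-≤ f (x ∷ xs) (fx≤c ∷ h) = +-mono-≤ fx≤c (sum-map-≤ f xs h)

map-≡⇒All-≡ : ∀ {A B : Set} {f g : A → B} xs → map f xs ≡ map g xs → All (λ x → f x ≡ g x) xs
map-≡⇒All-≡ []       _  = []
map-≡⇒All-≡ (x ∷ xs) eq = proj₁ (∷-injective eq) ∷ map-≡⇒All-≡ xs (proj₂ (∷-injective eq))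

module _ {X Y : Set} (_≟_ : DecidableEquality Y) (κ : X → Y) where

  fibre : Y → List X → List X
  fibre y = filter (λ x → κ x ≟ y)

  ∈-fibre⁻ : ∀ y xs {x} → x ∈ fibre y xs → x ∈ xs × κ x ≡ y
  ∈-fibre⁻ y xs = ∈-filter⁻ (λ x → κ x ≟ y) {xs = xs}

  length-fibre-∷ : ∀ y x xs →
                   length (fibre y (x ∷ xs)) ≡ length (fibre y [ x ]) + length (fibre y xs)
  length-fibre-∷ y x xs =
    trans (cong length (filter-++ (λ x → κ x ≟ y) [ x ] xs)) (length-++ (fibre y [ x ]))

  length-fibre-[]-≡ : ∀ x → length (fibre (κ x) [ x ]) ≡ 1
  length-fibre-[]-≡ x = cong length (filter-accept (λ x′ → κ x′ ≟ κ x) refl)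

  length-fibre-[]-≢ : ∀ {x y} → κ x ≢ y → length (fibre y [ x ]) ≡ 0
  length-fibre-[]-≢ {y = y} κx≢y = cong length (filter-reject (λ x′ → κ x′ ≟ y) κx≢y)

  length≤sum-length-fibres : ∀ ys xs → All (λ x → κ x ∈ ys) xs →
                             length xs ≤ sum (map (λ y → length (fibre y xs)) ys)
  length≤sum-length-fibres ys []       []                = z≤n
  length≤sum-length-fibres ys (x ∷ xs) (κx∈ys ∷ κxs∈ys) = begin
    suc (length xs)
      ≤⟨ +-mono-≤ (x-counted κx∈ys) (length≤sum-length-fibres ys xs κxs∈ys) ⟩
    sum (map (λ y → length (fibre y [ x ])) ys) + sum (map (λ y → length (fibre y xs)) ys)
      ≡⟨ sum-map-+ _ _ ys ⟨
    sum (map (λ y → length (fibre y [ x ]) + length (fibre y xs)) ys)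
      ≡⟨ cong sum (map-cong (λ y → length-fibre-∷ y x xs) ys) ⟨
    sum (map (λ y → length (fibre y (x ∷ xs))) ys)
      ∎
    where
    open ≤-Reasoning
    x-counted : ∀ {ys} → κ x ∈ ys → 1 ≤ sum (map (λ y → length (fibre y [ x ])) ys)
    x-counted (here refl)   = ≤-trans (≤-reflexive (sym (length-fibre-[]-≡ x))) (m≤m+n _ _)
    x-counted (there κx∈ys) = ≤-trans (x-counted κx∈ys) (m≤n+m _ _)

  pigeonhole : (y₀ : Y) (ys : List Y) (xs : List X) → All (λ x → κ x ∈ ys) xs →
               ∃ λ y → length xs ≤ length ys * length (fibre y xs)
  pigeonhole y₀ ys xs κxs∈ys = argmax size y₀ ys , ≤-trans
    (length≤sum-length-fibres ys xs κxs∈ys)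
    (sum-map-≤ size ys (f[xs]≤f[argmax] {f = size} y₀ ys))
    where
    size : Y → ℕ
    size y = length (fibre y xs)

  sum-length-fibre-[]-*-∉ : (g : Y → ℕ) {x : X} {ys : List Y} → All (κ x ≢_) ys →
                            sum (map (λ y → length (fibre y [ x ]) * g y) ys) ≡ 0
  sum-length-fibre-[]-*-∉ g []                                = refl
  sum-length-fibre-[]-*-∉ g {ys = y ∷ _} (κx≢y ∷ κx∉ys) =
    cong₂ _+_ (cong (_* g y) (length-fibre-[]-≢ κx≢y)) (sum-length-fibre-[]-*-∉ g κx∉ys)

  sum-length-fibre-[]-*-∈ : (g : Y → ℕ) {x : X} {ys : List Y} → Unique ys → κ x ∈ ys →
                            sum (map (λ y → length (fibre y [ x ]) * g y) ys) ≡ g (κ x)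
  sum-length-fibre-[]-*-∈ g {x} (κx∉ys ∷ _) (here refl) =
    trans (cong₂ _+_ (cong (_* g (κ x)) (length-fibre-[]-≡ x)) (sum-length-fibre-[]-*-∉ g κx∉ys))
          (trans (+-identityʳ _) (*-identityˡ _))
  sum-length-fibre-[]-*-∈ g {ys = y ∷ _} (y∉ys ∷ ys!) (there κx∈ys) =
    cong₂ _+_ (cong (_* g y) (length-fibre-[]-≢ (≢-sym (All.lookup y∉ys κx∈ys))))
              (sum-length-fibre-[]-*-∈ g ys! κx∈ys)

  sum-map-∘≡sum-fibres : (g : Y → ℕ) {ys : List Y} → Unique ys → ∀ xs → All (λ x → κ x ∈ ys) xs →
                         sum (map (g ∘ κ) xs) ≡ sum (map (λ y → length (fibre y xs) * g y) ys)
  sum-map-∘≡sum-fibres g {ys} ys! []       []                = sym (sum-map-0 ys)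
    where
    sum-map-0 : ∀ ys → sum (map (λ _ → 0) ys) ≡ 0
    sum-map-0 []       = refl
    sum-map-0 (_ ∷ ys) = sum-map-0 ys
  sum-map-∘≡sum-fibres g {ys} ys! (x ∷ xs) (κx∈ys ∷ κxs∈ys) = begin
    g (κ x) + sum (map (g ∘ κ) xs)
      ≡⟨ cong₂ _+_ (sym (sum-length-fibre-[]-*-∈ g ys! κx∈ys))
                   (sum-map-∘≡sum-fibres g ys! xs κxs∈ys) ⟩
    sum (map (λ y → length (fibre y [ x ]) * g y) ys) + sum (map (λ y → length (fibre y xs) * g y) ys)
      ≡⟨ sum-map-+ _ _ ys ⟨
    sum (map (λ y → length (fibre y [ x ]) * g y + length (fibre y xs) * g y) ys)
      ≡⟨ cong sum (map-cong split ys) ⟨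
    sum (map (λ y → length (fibre y (x ∷ xs)) * g y) ys)
      ∎
    where
    open ≡-Reasoning
    split : ∀ y → length (fibre y (x ∷ xs)) * g y
                ≡ length (fibre y [ x ]) * g y + length (fibre y xs) * g y
    split y = trans (cong (_* g y) (length-fibre-∷ y x xs))
                    (*-distribʳ-+ (g y) (length (fibre y [ x ])) (length (fibre y xs)))

length-cartesianProductWith : ∀ {A B C : Set} (f : A → B → C) xs ys →
                              length (cartesianProductWith f xs ys) ≡ length xs * length ys
length-cartesianProductWith f []       ys = refl
length-cartesianProductWith f (x ∷ xs) ys = begin
  length (map (f x) ys ++ cartesianProductWith f xs ys)
    ≡⟨ length-++ (map (f x) ys) ⟩
  length (map (f x) ys) + length (cartesianProductWith f xs ys)
    ≡⟨ cong₂ _+_ (length-map (f x) ys) (length-cartesianProductWith f xs ys) ⟩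
  length ys + length xs * length ys
    ∎
  where open ≡-Reasoning

tuples : ∀ {A : Set} → ℕ → List A → List (List A)
tuples zero    as = [ [] ]
tuples (suc n) as = cartesianProductWith _∷_ as (tuples n as)

length-tuples : ∀ {A : Set} n (as : List A) → length (tuples n as) ≡ length as ^ n
length-tuples zero    as = refl
length-tuples (suc n) as =
  trans (length-cartesianProductWith _∷_ as (tuples n as)) (cong (length as *_) (length-tuples n as))

map-∈-tuples : ∀ {A B : Set} {as : List A} (f : B → A) → (∀ b → f b ∈ as) →
               ∀ bs → map f bs ∈ tuples (length bs) as
map-∈-tuples f f∈as []       = here refl
map-∈-tuples f f∈as (b ∷ bs) = ∈-cartesianProductWith⁺ _∷_ (f∈as b) (map-∈-tuples f f∈as bs)

module _ {A : Set} {P Q : A → Set} (P? : Decidable₁ P) (Q? : Decidable₁ Q)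
         (P⇒Q : ∀ {x} → P x → Q x) where

  length-filter-≤ : ∀ xs → length (filter P? xs) ≤ length (filter Q? xs)
  length-filter-≤ []       = z≤n
  length-filter-≤ (x ∷ xs) with P? x | Q? x
  ... | yes _  | yes _  = s≤s (length-filter-≤ xs)
  ... | yes Px | no ¬Qx = ⊥-elim (¬Qx (P⇒Q Px))
  ... | no _   | yes _  = m≤n⇒m≤1+n (length-filter-≤ xs)
  ... | no _   | no _   = length-filter-≤ xs

  length-filter-< : ∀ {y xs} → y ∈ xs → Q y → ¬ P y → length (filter P? xs) < length (filter Q? xs)
  length-filter-< {xs = x ∷ xs} (here refl) Qx ¬Px
    rewrite filter-reject P? {xs = xs} ¬Px | filter-accept Q? {xs = xs} Qx = s≤s (length-filter-≤ xs)
  length-filter-< {xs = x ∷ xs} (there y∈xs) Qy ¬Py with P? x | Q? x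
  ... | yes _  | yes _  = s≤s (length-filter-< y∈xs Qy ¬Py)
  ... | yes Px | no ¬Qx = ⊥-elim (¬Qx (P⇒Q Px))
  ... | no _   | yes _  = m<n⇒m<1+n (length-filter-< y∈xs Qy ¬Py)
  ... | no _   | no _   = length-filter-< y∈xs Qy ¬Py

¬¬-decidable : ∀ {X : Set} {s} → Fin s ↔ X → (R : X → X → Set) → ¬ ¬ Decidable R
¬¬-decidable fin R = ¬¬-map transport
  (sequence ¬¬-applicative λ i → sequence ¬¬-applicative λ j → ¬¬-excluded-middle)
  where
  open Inverse fin using (to; from; strictlyInverseˡ)
  ¬¬-applicative : RawApplicative DoubleNegation
  ¬¬-applicative = RawMonad.rawApplicative ¬¬-Monad
  transport : (∀ i j → Dec (R (to i) (to j))) → Decidable R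
  transport d x y =
    subst₂ (λ a b → Dec (R a b)) (strictlyInverseˡ x) (strictlyInverseˡ y) (d (from x) (from y))

module _ {X : Set} {_~_ : X → X → Set} (~⁺? : Decidable (TransClosure _~_)) (A : List X) where

  rank : X → ℕ
  rank x = length (filter (λ a → ~⁺? a x) A)

  rank-strict : ∀ {x y} → ¬ TransClosure _~_ x x → x ∈ A → x ~ y → rank x < rank y
  rank-strict x≁⁺x x∈A x~y =
    length-filter-< (λ a → ~⁺? a _) (λ a → ~⁺? a _) (_∷ʳ x~y) x∈A [ x~y ]⁺ x≁⁺x

module _ {k} (H : DHG k) where

  coords : ∀ n → V (H ^⊠ n) → List (V H)
  coords zero    _       = []
  coords (suc n) (x , v) = v ∷ coords n x

  length-coords : ∀ n x → length (coords n x) ≡ n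
  length-coords zero    _       = refl
  length-coords (suc n) (x , _) = cong suc (length-coords n x)

  weight : (V H → ℕ) → ∀ n → V (H ^⊠ n) → ℕ
  weight f n x = sum (map f (coords n x))

  powerList : List (V H) → ∀ n → List (V (H ^⊠ n))
  powerList A zero    = [ tt ]
  powerList A (suc n) = cartesianProduct (powerList A n) A

  powerList-unique : ∀ {A} → Unique A → ∀ n → Unique (powerList A n)
  powerList-unique A! zero    = [] ∷ []
  powerList-unique A! (suc n) = Unique.cartesianProduct⁺ (powerList-unique A! n) A!

  length-powerList : ∀ A n → length (powerList A n) ≡ length A ^ n
  length-powerList A zero    = refl
  length-powerList A (suc n) = begin
    length (cartesianProduct (powerList A n) A) ≡⟨ length-cartesianProductWith _,_ (powerList A n) A ⟩
    length (powerList A n) * length A           ≡⟨ cong (_* length A) (length-powerList A n) ⟩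
    length A ^ n * length A                     ≡⟨ *-comm (length A ^ n) (length A) ⟩
    length A ^ suc n                            ∎
    where open ≡-Reasoning

  ∈-powerList⇒coords⊆ : ∀ {A} n {x} → x ∈ powerList A n → All (_∈ A) (coords n x)
  ∈-powerList⇒coords⊆ zero    _ = []
  ∈-powerList⇒coords⊆ {A} (suc n) x∈
    with x∈An , v∈A ← ∈-cartesianProduct⁻ (powerList A n) A x∈ = v∈A ∷ ∈-powerList⇒coords⊆ n x∈An

  AllIn-powerList-suc⁻ : ∀ {A n} (t : Fin k → V (H ^⊠ suc n)) → AllIn t (powerList A (suc n)) →
                         AllIn (proj₁ ∘ t) (powerList A n) × AllIn (proj₂ ∘ t) A
  AllIn-powerList-suc⁻ {A} {n} t t∈ =
    (λ i → proj₁ (∈-cartesianProduct⁻ (powerList A n) A (t∈ i))) ,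
    (λ i → proj₂ (∈-cartesianProduct⁻ (powerList A n) A (t∈ i)))

module _ {m} (H : DHG (suc (suc m))) (A : List (V H)) where

  weight-strict : ∀ {f} → f Preserves GraphOfInduced H A ⟶ _<_ →
                  ∀ n → weight H f n Preserves GraphOfInduced (H ^⊠ n) (powerList H A n) ⟶ _<_
  weight-strict f-strict zero (_ , () , _)
  weight-strict {f} f-strict (suc n) (t , e , t∈ , refl , refl)
    with fst∈ , snd∈ ← AllIn-powerList-suc⁻ H {A} {n} t t∈ | e
  ... | inj₁ (fst-const , snd-edge) =
    +-mono-<-≤ (f-strict (proj₂ ∘ t , snd-edge , snd∈ , refl , refl))
               (≤-reflexive (cong (weight H f n) (fst-const zero (suc zero))))
  ... | inj₂ (inj₁ (fst-edge , snd-const)) =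
    +-mono-≤-< (≤-reflexive (cong f (snd-const zero (suc zero))))
               (weight-strict f-strict n (proj₁ ∘ t , fst-edge , fst∈ , refl , refl))
  ... | inj₂ (inj₂ (fst-edge , snd-edge)) =
    +-mono-< (f-strict (proj₂ ∘ t , snd-edge , snd∈ , refl , refl))
             (weight-strict f-strict n (proj₁ ∘ t , fst-edge , fst∈ , refl , refl))

module _ {m} (H : DHG (suc (suc m))) (H-finite : IsFinite H)
         (A : List (V H)) (A-acyclic : IsAcyclicSet H A) where

  _≟ᵥ_ : DecidableEquality (V H)
  _≟ᵥ_ = via-injection (↔⇒↣ (↔-sym (proj₂ H-finite))) Fin._≟_

  count : V H → List (V H) → ℕ
  count v xs = length (fibre _≟ᵥ_ id v xs)

  typeOf : ∀ n → V (H ^⊠ n) → List ℕ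
  typeOf n x = map (λ v → count v (coords H n x)) A

  typeClass : ∀ n → List ℕ → List (V (H ^⊠ n))
  typeClass n τ = fibre (≡-dec _≟_) (typeOf n) τ (powerList H A n)

  typeOf∈tuples : ∀ n x → typeOf n x ∈ tuples (length A) (upTo (suc n))
  typeOf∈tuples n x = map-∈-tuples _ (λ v → ∈-upTo⁺ (s≤s (count≤n v))) A
    where
    count≤n : ∀ v → count v (coords H n x) ≤ n
    count≤n v = subst (count v (coords H n x) ≤_) (length-coords H n x)
                      (length-filter (_≟ᵥ v) (coords H n x))

  weight-typeOf : ∀ f n {x y} → x ∈ powerList H A n → y ∈ powerList H A n →
                  typeOf n x ≡ typeOf n y → weight H f n x ≡ weight H f n y
  weight-typeOf f n {x} {y} x∈ y∈ same-type = begin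
    sum (map f (coords H n x))
      ≡⟨ sum-map-∘≡sum-fibres _≟ᵥ_ id f (proj₁ A-acyclic) _ (∈-powerList⇒coords⊆ H n x∈) ⟩
    sum (map (λ v → count v (coords H n x) * f v) A)
      ≡⟨ cong sum (map-cong-local (All.map (cong (_* f _)) (map-≡⇒All-≡ A same-type))) ⟩
    sum (map (λ v → count v (coords H n y) * f v) A)
      ≡⟨ sum-map-∘≡sum-fibres _≟ᵥ_ id f (proj₁ A-acyclic) _ (∈-powerList⇒coords⊆ H n y∈) ⟨
    sum (map f (coords H n y))
      ∎
    where open ≡-Reasoning

  ¬¬-strict-rank : ¬ ¬ (∃ λ (f : V H → ℕ) → f Preserves GraphOfInduced H A ⟶ _<_)
  ¬¬-strict-rank =
    ¬¬-map strict-rank (¬¬-decidable (proj₂ H-finite) (TransClosure (GraphOfInduced H A)))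
    where
    strict-rank : Decidable (TransClosure (GraphOfInduced H A)) →
                  ∃ λ (f : V H → ℕ) → f Preserves GraphOfInduced H A ⟶ _<_
    strict-rank ~⁺? = rank ~⁺? A , λ { x~y@(t , _ , t∈A , refl , _) →
      rank-strict ~⁺? A (proj₂ A-acyclic _) (t∈A zero) x~y }

  typeClass-independent : ∀ n τ t → E (H ^⊠ n) t → ¬ AllIn t (typeClass n τ)
  typeClass-independent n τ t e t∈class = ¬¬-strict-rank λ (f , f-strict) →
    <-irrefl (weight-typeOf f n (t∈ zero) (t∈ (suc zero)) (trans (type zero) (sym (type (suc zero)))))
             (weight-strict H A f-strict n (t , e , t∈ , refl , refl))
    where
    t∈ : AllIn t (powerList H A n)
    t∈ i = proj₁ (∈-fibre⁻ (≡-dec _≟_) (typeOf n) τ (powerList H A n) (t∈class i))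
    type : ∀ i → typeOf n (t i) ≡ τ
    type i = proj₂ (∈-fibre⁻ (≡-dec _≟_) (typeOf n) τ (powerList H A n) (t∈class i))

  large-independent-set : ∀ n → ∃ λ S → IsIndependent (H ^⊠ n) S × length A ^ n ≤ suc n ^ length A * length S
  large-independent-set n
    with τ , large ← pigeonhole (≡-dec _≟_) (typeOf n) [] (tuples (length A) (upTo (suc n)))
                                (powerList H A n) (All.tabulate λ {x} _ → typeOf∈tuples n x)
    = typeClass n τ
    , (Unique.filter⁺ _ (powerList-unique H (proj₁ A-acyclic) n) , typeClass-independent n τ)
    , subst₂ _≤_ (length-powerList H A n) (cong (_* length (typeClass n τ)) number-of-types) large
    where
    number-of-types : length (tuples (length A) (upTo (suc n))) ≡ suc n ^ length A
    number-of-types =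
      trans (length-tuples (length A) (upTo (suc n))) (cong (_^ length A) (length-upTo (suc n)))

theorem2p21 : (m : ℕ) (H : DHG (suc (suc m))) → IsFinite H →
    (A : List (V H)) → IsAcyclicSet H A →
    (p q : ℕ) → 0 < q → p < q * length A →
    ∃ λ N → (n : ℕ) → N ≤ n → ∃ λ S → IsIndependent (H ^⊠ n) S × p ^ n ≤ q ^ n * length S
theorem2p21 m H H-finite A A-acyclic p q _ p<q|A|
  with N , eventually ← a^n*[1+n]^d≤b^n-eventually (length A) p<q|A|
  = N , λ n N≤n →
    let S , S-independent , S-large = large-independent-set H H-finite A A-acyclic n
        c = suc n ^ length A
        open ≤-Reasoning
    in S , S-independent , *-cancelʳ-≤ (p ^ n) (q ^ n * length S) c {{m^n≢0 (suc n) (length A)}} (begin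
      p ^ n * c                 ≤⟨ eventually n N≤n ⟩
      (q * length A) ^ n        ≡⟨ ^-distrib-* q (length A) n ⟩
      q ^ n * length A ^ n      ≤⟨ *-monoʳ-≤ (q ^ n) S-large ⟩
      q ^ n * (c * length S)    ≡⟨ x∙yz≈xz∙y (q ^ n) c (length S) ⟩
      q ^ n * length S * c      ∎)
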